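{- For every integer $i\ge 7$, let $S_i:=F_{i-1}[1\ldots f_{i-1}-2]$ be the prefix of $F_{i-1}$ of length $f_{i-1}-2$. Taking $F_i$ as the text, the net frequency of $S_i$ in $F_i$ satisfies $\phi(S_i)\ge 2$.
   Context: Fibonacci words: $F_1=\texttt{b}$, $F_2=\texttt{a}$, $F_i=F_{i-1}F_{i-2}$ for $i\ge 3$; $f_i=|F_i|$. For a text $T$ of length $n$, let $f(W)$ be the number of occurrences of $W$ in $T$. An occurrence $(s,e)$, $1\le s\le e\le n$, is a net occurrence if $f(T[s\ldots e])\ge 2$, $f(T[s-1\ldots e])=1$ and $f(T[s\ldots e+1])=1$, where the second condition is considered true when $s=1$ and the third when $e=n$. The net frequency $\phi(S)$ of $S$ in $T$ is the number of net occurrences $(s,e)$ with $T[s\ldots e]=S$. -}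

module Defs where

open import Data.Nat using (ℕ; zero; suc; _+_; _∸_; _≤ᵇ_; _≡ᵇ_)
open import Data.List using (List; []; _∷_; _++_; length; take; drop; filterᵇ; map; upTo)
open import Data.Bool using (Bool; true; false; _∧_; _∨_)

data Letter : Set where
  a b : Letter

Word : Set
Word = List Letter

-- Fibonacci words, 1-indexed: F 1 = b, F 2 = a, F i = F (i-1) F (i-2) for i ≥ 3.
-- (F 0 is an unused filler value.)
F : ℕ → Word
F 0 = []
F 1 = b ∷ []
F 2 = a ∷ []
F (suc (suc (suc i))) = F (suc (suc i)) ++ F (suc i)

f : ℕ → ℕ
f i = length (F i)

_==ᴸ_ : Letter → Letter → Bool
a ==ᴸ a = true
b ==ᴸ b = true
_ ==ᴸ _ = false

_==_ : Word → Word → Bool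
[] == [] = true
(x ∷ xs) == (y ∷ ys) = (x ==ᴸ y) ∧ (xs == ys)
_ == _ = false

-- T[s … e], 1-based inclusive indices
sub : Word → ℕ → ℕ → Word
sub T s e = take (suc e ∸ s) (drop (s ∸ 1) T)

positions : ℕ → List ℕ
positions n = map suc (upTo n)

occursAt : Word → Word → ℕ → Bool
occursAt T W s = ((s + length W) ≤ᵇ suc (length T)) ∧ (W == sub T s (s + length W ∸ 1))

-- f(W): number of occurrences of W in T (W assumed nonempty in uses below)
count : Word → Word → ℕ
count T W = length (filterᵇ (occursAt T W) (positions (length T)))

-- (s, e) is a net occurrence in T (1 ≤ s ≤ e ≤ n assumed):
--   f(T[s…e]) ≥ 2, (s = 1 or f(T[s-1…e]) = 1), (e = n or f(T[s…e+1]) = 1)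
isNet : Word → ℕ → ℕ → Bool
isNet T s e =
  (2 ≤ᵇ count T (sub T s e))
  ∧ ((s ≡ᵇ 1) ∨ (count T (sub T (s ∸ 1) e) ≡ᵇ 1))
  ∧ ((e ≡ᵇ length T) ∨ (count T (sub T s (suc e)) ≡ᵇ 1))

-- φ(S) in T: number of net occurrences (s, e) with T[s…e] = S,
-- i.e. number of s ∈ {1..n} with S occurring at s and (s, s+|S|-1) net.
-- (S assumed nonempty, so 1 ≤ s ≤ e.)
netFreq : Word → Word → ℕ
netFreq T S = length (filterᵇ (λ s → occursAt T S s ∧ isNet T s (s + length S ∸ 1)) (positions (length T)))

Sw : ℕ → Word
Sw i = take (f (i ∸ 1) ∸ 2) (F (i ∸ 1))

-- Write t = F (7 + k) = F (6 + k) F (5 + k), A = f (5 + k), and S for F (6 + k) without its last two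
-- letters. Since F (6 + k) F (5 + k) and F (5 + k) F (6 + k) agree up to their last two letters, S
-- occurs in t at the positions 0 and A. It occurs nowhere else, since another occurrence would give a
-- prefix of the infinite Fibonacci word a period that is too short for its length: the prefix of length
-- f (K + 1) - 1 has no period below f K. The letters following the two occurrences are the penultimate
-- letters of F (6 + k) and F (7 + k), which differ. So the right extensions of both occurrences, and
-- the left extension of the second, occur only once, and both occurrences are net.

module Submission where

open import Defs
open import Data.Nat using (ℕ; _≤_; _≥_)
open import Data.Nat using (zero; suc; _+_; _∸_; _⊓_; _<_; z≤n; s≤s; s≤s⁻¹; _≤ᵇ_; _<?_; _≟_)
open import Data.Nat.Properties
open import Data.Nat.Tactic.RingSolver using (solve-∀)
open import Data.List using ([]; _∷_; _++_; length; take; drop; filterᵇ; map; upTo)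
open import Data.List.Properties
  using (length-++; length-take; length-drop; map-++; ++-assoc; ++-identityʳ; upTo-∷ʳ;
         filter-++; filter-accept; filter-reject)
open import Data.Bool using (Bool; T; T?; _∧_; _∨_)
open import Data.Bool.Properties using (T-∧; T-∨)
open import Data.Product using (Σ; _×_; _,_; proj₁; proj₂)
open import Data.Sum using (_⊎_; inj₁; inj₂)
import Data.Sum as Sum
open import Data.Unit using (tt)
open import Data.Empty using (⊥; ⊥-elim)
open import Function using (_∘_)
open import Function.Bundles using (Equivalence)
open import Relation.Nullary using (¬_; yes; no; contradiction)
open import Relation.Binary using (tri<; tri≈; tri>)
open import Relation.Binary.PropositionalEquality

-- Letters past the end of a word read as the junk value a.
nth : Word → ℕ → Letter
nth []      _       = a
nth (c ∷ w) zero    = c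
nth (c ∷ w) (suc j) = nth w j

nth-++ˡ : ∀ u {v} {j} → j < length u → nth (u ++ v) j ≡ nth u j
nth-++ˡ (c ∷ u) {j = zero}  _         = refl
nth-++ˡ (c ∷ u) {j = suc j} (s≤s j<u) = nth-++ˡ u j<u

nth-++ʳ : ∀ u {v} j → nth (u ++ v) (length u + j) ≡ nth v j
nth-++ʳ []      j = refl
nth-++ʳ (c ∷ u) j = nth-++ʳ u j

nth-take : ∀ n w {j} → j < length (take n w) → nth (take n w) j ≡ nth w j
nth-take (suc n) (c ∷ w) {zero}  _         = refl
nth-take (suc n) (c ∷ w) {suc j} (s≤s j<w) = nth-take n w j<w

nth-drop : ∀ n w j → nth (drop n w) j ≡ nth w (n + j)
nth-drop zero    w       j = refl
nth-drop (suc n) []      j = refl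
nth-drop (suc n) (c ∷ w) j = nth-drop n w j

nth-ext : ∀ u v → length u ≡ length v → (∀ j → j < length u → nth u j ≡ nth v j) → u ≡ v
nth-ext []      []      _     _  = refl
nth-ext (c ∷ u) (d ∷ v) |u|≡|v| eq =
  cong₂ _∷_ (eq 0 (s≤s z≤n)) (nth-ext u v (suc-injective |u|≡|v|) (λ j j<u → eq (suc j) (s≤s j<u)))

penultimate : Word → Letter
penultimate w = nth w (length w ∸ 2)

penultimate-++ : ∀ u {v} → 2 ≤ length v → penultimate (u ++ v) ≡ penultimate v
penultimate-++ u {v} 2≤v = begin
  nth (u ++ v) (length (u ++ v) ∸ 2)       ≡⟨ cong (λ l → nth (u ++ v) (l ∸ 2)) (length-++ u) ⟩
  nth (u ++ v) (length u + length v ∸ 2)   ≡⟨ cong (nth (u ++ v)) (+-∸-assoc (length u) 2≤v) ⟩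
  nth (u ++ v) (length u + (length v ∸ 2)) ≡⟨ nth-++ʳ u _ ⟩
  nth v (length v ∸ 2)                     ∎
  where open ≡-Reasoning

≤-suc⇒mono-≤ : ∀ (g : ℕ → ℕ) → (∀ n → g n ≤ g (suc n)) → ∀ {m n} → m ≤ n → g m ≤ g n
≤-suc⇒mono-≤ g step {n = zero}  z≤n = ≤-refl
≤-suc⇒mono-≤ g step {n = suc n} m≤1+n with m≤n⇒m<n∨m≡n m≤1+n
... | inj₁ m<1+n = ≤-trans (≤-suc⇒mono-≤ g step (s≤s⁻¹ m<1+n)) (step n)
... | inj₂ refl  = ≤-refl

f-rec : ∀ k → f (3 + k) ≡ f (2 + k) + f (1 + k)
f-rec k = length-++ (F (2 + k))

f≤f-suc : ∀ n → f n ≤ f (suc n)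
f≤f-suc 0             = z≤n
f≤f-suc 1             = ≤-refl
f≤f-suc (suc (suc k)) = subst (f (2 + k) ≤_) (sym (f-rec k)) (m≤m+n _ _)

f-mono-≤ : ∀ {m n} → m ≤ n → f m ≤ f n
f-mono-≤ = ≤-suc⇒mono-≤ f f≤f-suc

2≤f[3+k] : ∀ k → 2 ≤ f (3 + k)
2≤f[3+k] k = f-mono-≤ (m≤m+n 3 k)

n<f[2+n] : ∀ n → n < f (2 + n)
n<f[2+n] zero    = s≤s z≤n
n<f[2+n] (suc n) = begin-strict
  suc n                 ≤⟨ n<f[2+n] n ⟩
  f (2 + n)             <⟨ m<m+n (f (2 + n)) (f-mono-≤ (s≤s (z≤n {n}))) ⟩
  f (2 + n) + f (1 + n) ≡⟨ f-rec n ⟨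
  f (3 + n)             ∎
  where open ≤-Reasoning

F-prefix : ∀ k d → Σ Word λ w → F (2 + (d + k)) ≡ F (2 + k) ++ w
F-prefix k zero    = [] , sym (++-identityʳ (F (2 + k)))
F-prefix k (suc d) with F-prefix k d
... | w , F≡ = w ++ F (1 + (d + k)) , trans (cong (_++ F (1 + (d + k))) F≡) (++-assoc (F (2 + k)) w _)

-- The infinite Fibonacci word; F (2 + j) is one of its prefixes, of length > j.
fib∞ : ℕ → Letter
fib∞ j = nth (F (2 + j)) j

nth-F : ∀ k {j} → j < f (2 + k) → nth (F (2 + k)) j ≡ fib∞ j
nth-F k {j} j<f = begin
  nth (F (2 + k)) j       ≡⟨ nth-prefix (F-prefix k j) j<f ⟨
  nth (F (2 + (j + k))) j ≡⟨ cong (λ i → nth (F (2 + i)) j) (+-comm j k) ⟩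
  nth (F (2 + (k + j))) j ≡⟨ nth-prefix (F-prefix j k) (n<f[2+n] j) ⟩
  fib∞ j                  ∎
  where
  open ≡-Reasoning
  nth-prefix : ∀ {u v} → Σ Word (λ w → u ≡ v ++ w) → j < length v → nth u j ≡ nth v j
  nth-prefix {v = v} (w , refl) = nth-++ˡ v

fib∞-shift : ∀ k {j} → j < f (2 + k) → fib∞ (f (3 + k) + j) ≡ fib∞ j
fib∞-shift k {j} j<f₂ = begin
  fib∞ (f (3 + k) + j)            ≡⟨ nth-F (2 + k) bound ⟨
  nth (F (4 + k)) (f (3 + k) + j) ≡⟨ nth-++ʳ (F (3 + k)) j ⟩
  nth (F (2 + k)) j               ≡⟨ nth-F k j<f₂ ⟩
  fib∞ j                          ∎
  where
  open ≡-Reasoning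
  bound : f (3 + k) + j < f (4 + k)
  bound = subst (f (3 + k) + j <_) (sym (f-rec (1 + k))) (+-monoʳ-< (f (3 + k)) j<f₂)

-- F (3 + k) F (2 + k) and F (2 + k) F (3 + k) differ only in their last two letters.
fib∞-period : ∀ k j → j + 2 < f (3 + k) → fib∞ (f (2 + k) + j) ≡ fib∞ j
fib∞-period zero j j+2<2 = contradiction j+2<2 (m+n≮n j 2)
fib∞-period (suc k) j j+2<f₄ with j <? f (2 + k)
... | yes j<f₂ = fib∞-shift k j<f₂
... | no j≮f₂ with m≤n⇒∃[o]m+o≡n (≮⇒≥ j≮f₂)
... | i , refl = begin
  fib∞ (f (3 + k) + (f (2 + k) + i)) ≡⟨ cong fib∞ (+-assoc (f (3 + k)) (f (2 + k)) i) ⟨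
  fib∞ (f (3 + k) + f (2 + k) + i)   ≡⟨ cong (λ l → fib∞ (l + i)) (f-rec (1 + k)) ⟨
  fib∞ (f (4 + k) + i)               ≡⟨ fib∞-shift (1 + k) (m+n≤o⇒m≤o (suc i) i+2<f₃) ⟩
  fib∞ i                             ≡⟨ fib∞-period k i i+2<f₃ ⟨
  fib∞ (f (2 + k) + i)               ∎
  where
  open ≡-Reasoning
  i+2<f₃ : i + 2 < f (3 + k)
  i+2<f₃ = +-cancelˡ-< (f (2 + k)) (i + 2) (f (3 + k))
    (subst₂ _<_ (+-assoc (f (2 + k)) i 2) (trans (f-rec (1 + k)) (+-comm (f (3 + k)) (f (2 + k)))) j+2<f₄)

penultimate-F : ∀ k → penultimate (F (3 + k)) ≢ penultimate (F (4 + k))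
penultimate-F zero    ()
penultimate-F (suc k) eq = penultimate-F k (sym (trans eq (penultimate-++ (F (4 + k)) (2≤f[3+k] k))))

fib∞-penultimate : ∀ k → fib∞ (f (3 + k) ∸ 2) ≢ fib∞ (f (4 + k) ∸ 2)
fib∞-penultimate k eq = penultimate-F k (begin
  penultimate (F (3 + k)) ≡⟨ nth-F (1 + k) (∸2< (2≤f[3+k] k)) ⟩
  fib∞ (f (3 + k) ∸ 2)    ≡⟨ eq ⟩
  fib∞ (f (4 + k) ∸ 2)    ≡⟨ nth-F (2 + k) (∸2< (2≤f[3+k] (1 + k))) ⟨
  penultimate (F (4 + k)) ∎)
  where
  open ≡-Reasoning
  ∸2< : ∀ {n} → 2 ≤ n → n ∸ 2 < n
  ∸2< {suc (suc n)} (s≤s (s≤s _)) = m<n⇒m<1+n (n<1+n n)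

Periodic : ℕ → ℕ → Set
Periodic L p = ∀ j → j + p < L → fib∞ j ≡ fib∞ (j + p)

periodic-reflect : ∀ k {p r L} → p + r ≡ f (3 + k) → 0 < r → f (4 + k) ≤ suc L →
                   Periodic L p → Periodic (f (2 + k)) r
periodic-reflect k {p} {r} {L} p+r≡f₃ 0<r f₄≤1+L per j j+r<f₂ = begin
  fib∞ j               ≡⟨ fib∞-shift k (≤-<-trans (m≤m+n j r) j+r<f₂) ⟨
  fib∞ (f (3 + k) + j) ≡⟨ cong fib∞ shift ⟩
  fib∞ (j + r + p)     ≡⟨ per (j + r) bound ⟨
  fib∞ (j + r)         ∎
  where
  open ≡-Reasoning
  shift : f (3 + k) + j ≡ j + r + p
  shift = trans (cong (_+ j) (sym p+r≡f₃)) (rearrange p r j)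
    where
    rearrange : ∀ p r j → p + r + j ≡ j + r + p
    rearrange = solve-∀
  2+j≤f₂ : 2 + j ≤ f (2 + k)
  2+j≤f₂ = ≤-trans (s≤s (≤-trans (≤-reflexive (+-comm 1 j)) (+-monoʳ-≤ j 0<r))) j+r<f₂
  bound : j + r + p < L
  bound = s≤s⁻¹ (subst (_≤ suc L) (trans (+-suc² (f (3 + k)) j) (cong (2 +_) shift))
    (≤-trans (+-monoʳ-≤ (f (3 + k)) 2+j≤f₂) (subst (_≤ suc L) (f-rec (1 + k)) f₄≤1+L)))
    where
    +-suc² : ∀ m n → m + (2 + n) ≡ 2 + (m + n)
    +-suc² = solve-∀

NoShortPeriod : ℕ → Set
NoShortPeriod K = ∀ {p L} → 0 < p → p < f K → f (suc K) ≤ suc L → ¬ Periodic L p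

-- A period p between f (2 + k) and f (3 + k) reflects to the period f (3 + k) ∸ p of a shorter prefix;
-- the period f (2 + k) itself is broken by the penultimate letters of F (3 + k) and F (4 + k).
no-short-period-step : ∀ k → NoShortPeriod (1 + k) → NoShortPeriod (2 + k) → NoShortPeriod (3 + k)
no-short-period-step k nsp₁ nsp₂ {p} {L} 0<p p<f₃ f₄≤1+L per with <-cmp p (f (2 + k))
... | tri< p<f₂ _ _ = nsp₂ 0<p p<f₂ (≤-trans (f≤f-suc (3 + k)) f₄≤1+L) per
... | tri≈ _ refl _ = fib∞-penultimate k (trans (per (f (3 + k) ∸ 2) bound) (cong fib∞ shift))
  where
  shift : f (3 + k) ∸ 2 + f (2 + k) ≡ f (4 + k) ∸ 2
  shift = trans (sym (+-∸-comm (f (2 + k)) (2≤f[3+k] k))) (cong (_∸ 2) (sym (f-rec (1 + k))))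
  bound : f (3 + k) ∸ 2 + f (2 + k) < L
  bound = s≤s⁻¹ (subst (_≤ suc L) (trans (sym (m+[n∸m]≡n (2≤f[3+k] (1 + k)))) (cong (2 +_) (sym shift)))
                       f₄≤1+L)
... | tri> _ _ f₂<p = nsp₁ 0<r r<f₁ (n≤1+n _) (periodic-reflect k (m+[n∸m]≡n (<⇒≤ p<f₃)) 0<r f₄≤1+L per)
  where
  0<r : 0 < f (3 + k) ∸ p
  0<r = m<n⇒0<n∸m p<f₃
  r<f₁ : f (3 + k) ∸ p < f (1 + k)
  r<f₁ = subst (f (3 + k) ∸ p <_) (trans (cong (_∸ f (2 + k)) (f-rec k)) (m+n∸m≡n (f (2 + k)) (f (1 + k))))
    (∸-monoʳ-< f₂<p (<⇒≤ p<f₃))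

no-short-period : ∀ K → NoShortPeriod K
no-short-period 0                   _         ()
no-short-period 1                   (s≤s z≤n) (s≤s ())
no-short-period 2                   (s≤s z≤n) (s≤s ())
no-short-period (suc (suc (suc k))) =
  no-short-period-step k (no-short-period (suc k)) (no-short-period (suc (suc k)))

tally : (ℕ → Bool) → ℕ → ℕ
tally P n = length (filterᵇ P (positions n))

tally-suc : ∀ P n → tally P (suc n) ≡ tally P n + length (filterᵇ P (suc n ∷ []))
tally-suc P n = begin
  length (filterᵇ P (positions (suc n)))                     ≡⟨ cong (length ∘ filterᵇ P) positions-suc ⟩
  length (filterᵇ P (positions n ++ suc n ∷ []))             ≡⟨ cong length (filter-++ (T? ∘ P) (positions n) _) ⟩
  length (filterᵇ P (positions n) ++ filterᵇ P (suc n ∷ [])) ≡⟨ length-++ (filterᵇ P (positions n)) ⟩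
  tally P n + length (filterᵇ P (suc n ∷ []))                ∎
  where
  open ≡-Reasoning
  positions-suc : positions (suc n) ≡ positions n ++ suc n ∷ []
  positions-suc = trans (cong (map suc) (sym (upTo-∷ʳ n))) (map-++ suc (upTo n) (n ∷ []))

tally-hit : ∀ P n → T (P (suc n)) → tally P (suc n) ≡ suc (tally P n)
tally-hit P n hit =
  trans (tally-suc P n) (trans (cong (λ l → tally P n + length l) (filter-accept (T? ∘ P) hit)) (+-comm _ 1))

tally-miss : ∀ P n → ¬ T (P (suc n)) → tally P (suc n) ≡ tally P n
tally-miss P n miss =
  trans (tally-suc P n) (trans (cong (λ l → tally P n + length l) (filter-reject (T? ∘ P) miss)) (+-identityʳ _))

tally-none : ∀ P n → (∀ {q} → q < n → ¬ T (P (suc q))) → tally P n ≡ 0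
tally-none P zero    _    = refl
tally-none P (suc n) none = trans (tally-miss P n (none ≤-refl)) (tally-none P n (none ∘ m<n⇒m<1+n))

tally-unique : ∀ P {n q₀} → (∀ {q} → q < n → T (P (suc q)) → q ≡ q₀) → q₀ < n → T (P (suc q₀)) →
               tally P n ≡ 1
tally-unique P {suc n} {q₀} only q₀<1+n hit with q₀ ≟ n
... | yes refl =
  trans (tally-hit P n hit)
        (cong suc (tally-none P n (λ q<n hit′ → <-irrefl (only (m<n⇒m<1+n q<n) hit′) q<n)))
... | no q₀≢n =
  trans (tally-miss P n (λ hit′ → q₀≢n (sym (only ≤-refl hit′))))
        (tally-unique P (only ∘ m<n⇒m<1+n) (≤∧≢⇒< (s≤s⁻¹ q₀<1+n) q₀≢n) hit)

tally-mono-≤ : ∀ P {m n} → m ≤ n → tally P m ≤ tally P n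
tally-mono-≤ P = ≤-suc⇒mono-≤ (tally P) (λ n → subst (tally P n ≤_) (sym (tally-suc P n)) (m≤m+n _ _))

tally-two : ∀ P {n q₁ q₂} → q₁ < q₂ → q₂ < n → T (P (suc q₁)) → T (P (suc q₂)) → 2 ≤ tally P n
tally-two P {n} {q₁} {q₂} q₁<q₂ q₂<n hit₁ hit₂ = begin
  2                       ≤⟨ s≤s (≤-trans (s≤s z≤n) (≤-reflexive (sym (tally-hit P q₁ hit₁)))) ⟩
  suc (tally P (suc q₁))  ≤⟨ s≤s (tally-mono-≤ P q₁<q₂) ⟩
  suc (tally P q₂)        ≡⟨ tally-hit P q₂ hit₂ ⟨
  tally P (suc q₂)        ≤⟨ tally-mono-≤ P q₂<n ⟩
  tally P n               ∎
  where open ≤-Reasoning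

==⇒≡ : ∀ u v → T (u == v) → u ≡ v
==⇒≡ []      []      _     = refl
==⇒≡ (a ∷ u) (a ∷ v) u==v = cong (a ∷_) (==⇒≡ u v u==v)
==⇒≡ (b ∷ u) (b ∷ v) u==v = cong (b ∷_) (==⇒≡ u v u==v)

==-refl : ∀ u → T (u == u)
==-refl []      = tt
==-refl (a ∷ u) = ==-refl u
==-refl (b ∷ u) = ==-refl u

length-sub : ∀ (t : Word) {p e} → p ≤ e → e ≤ length t → length (sub t (suc p) e) ≡ e ∸ p
length-sub t {p} {e} p≤e e≤t = begin
  length (take (e ∸ p) (drop p t)) ≡⟨ length-take (e ∸ p) (drop p t) ⟩
  (e ∸ p) ⊓ length (drop p t)      ≡⟨ cong ((e ∸ p) ⊓_) (length-drop p t) ⟩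
  (e ∸ p) ⊓ (length t ∸ p)         ≡⟨ m≤n⇒m⊓n≡m (∸-monoˡ-≤ p e≤t) ⟩
  e ∸ p                            ∎
  where open ≡-Reasoning

nth-sub : ∀ (t : Word) {p e j} → j < length (sub t (suc p) e) → nth (sub t (suc p) e) j ≡ nth t (p + j)
nth-sub t {p} {e} {j} j<sub = trans (nth-take (e ∸ p) (drop p t) j<sub) (nth-drop p t j)

-- w occurs in t at the 0-based position p, i.e. at the 1-based position suc p of occursAt.
Occurs : Word → Word → ℕ → Set
Occurs t w p = p + length w ≤ length t × (∀ j → j < length w → nth t (p + j) ≡ nth w j)

sub-Occurs : ∀ (t w : Word) {p} → Occurs t w p → sub t (suc p) (p + length w) ≡ w
sub-Occurs t w {p} (fits , matches) =
  nth-ext _ w length-eq (λ j j<sub → trans (nth-sub t j<sub) (matches j (subst (j <_) length-eq j<sub)))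
  where
  length-eq : length (sub t (suc p) (p + length w)) ≡ length w
  length-eq = trans (length-sub t (m≤m+n p _) fits) (m+n∸m≡n p (length w))

Occurs-sub : ∀ (t : Word) {p e} → p ≤ e → e ≤ length t → Occurs t (sub t (suc p) e) p
Occurs-sub t {p} {e} p≤e e≤t =
  subst (_≤ length t) (sym (trans (cong (p +_) (length-sub t p≤e e≤t)) (m+[n∸m]≡n p≤e))) e≤t ,
  λ j j<sub → sym (nth-sub t j<sub)

occursAt⇒Occurs : ∀ (t w : Word) {p} → T (occursAt t w (suc p)) → Occurs t w p
occursAt⇒Occurs t w {p} occ with Equivalence.to T-∧ occ
... | fits , w==sub = s≤s⁻¹ (≤ᵇ⇒≤ _ _ fits) , matches
  where
  w≡sub : w ≡ sub t (suc p) (p + length w)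
  w≡sub = ==⇒≡ w _ w==sub
  matches : ∀ j → j < length w → nth t (p + j) ≡ nth w j
  matches j j<w = sym (trans (cong (λ v → nth v j) w≡sub) (nth-sub t (subst (λ v → j < length v) w≡sub j<w)))

Occurs⇒occursAt : ∀ (t w : Word) {p} → Occurs t w p → T (occursAt t w (suc p))
Occurs⇒occursAt t w occ@(fits , _) =
  Equivalence.from T-∧ (≤⇒≤ᵇ (s≤s fits) , subst (T ∘ (w ==_)) (sym (sub-Occurs t w occ)) (==-refl w))

count-factor : ∀ (t : Word) {p e} → p < e → e ≤ length t → (∀ {q} → Occurs t (sub t (suc p) e) q → q ≡ p) →
               count t (sub t (suc p) e) ≡ 1
count-factor t {p} {e} p<e e≤t unique =
  tally-unique (occursAt t u) (λ _ occ → unique (occursAt⇒Occurs t u occ)) (<-≤-trans p<e e≤t)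
    (Occurs⇒occursAt t u (Occurs-sub t (<⇒≤ p<e) e≤t))
  where
  u : Word
  u = sub t (suc p) e

-- sub t (suc p) (suc (p + length w)) extends an occurrence of w at p to the right,
-- and one at suc p to the left.
Occurs-extension : ∀ (t w : Word) {p q} → suc (p + length w) ≤ length t →
                   Occurs t (sub t (suc p) (suc (p + length w))) q →
                   q + suc (length w) ≤ length t × (∀ j → j ≤ length w → nth t (q + j) ≡ nth t (p + j))
Occurs-extension t w {p} {q} room (fits , matches) =
  subst (λ l → q + l ≤ length t) length-eq fits ,
  λ j j≤w → let j<ext = subst (j <_) (sym length-eq) (s≤s j≤w) in trans (matches j j<ext) (nth-sub t j<ext)
  where
  length-eq : length (sub t (suc p) (suc (p + length w))) ≡ suc (length w)
  length-eq = trans (length-sub t (m≤n⇒m≤1+n (m≤m+n p _)) room)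
                    (trans (cong (_∸ p) (sym (+-suc p (length w)))) (m+n∸m≡n p (suc (length w))))

count-right-extension :
  ∀ (t w : Word) {p} → Occurs t w p → p + length w < length t →
  (∀ {q} → Occurs t w q → q + length w < length t → nth t (q + length w) ≡ nth t (p + length w) → q ≡ p) →
  count t (sub t (suc p) (suc (p + length w))) ≡ 1
count-right-extension t w {p} (_ , w-at-p) room unique =
  count-factor t (s≤s (m≤m+n p _)) room from-extension
  where
  from-extension : ∀ {q} → Occurs t (sub t (suc p) (suc (p + length w))) q → q ≡ p
  from-extension {q} occ with Occurs-extension t w room occ
  ... | fits , matches =
    unique (<⇒≤ room′ , λ j j<w → trans (matches j (<⇒≤ j<w)) (w-at-p j j<w)) room′ (matches _ ≤-refl)
    where
    room′ : q + length w < length t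
    room′ = subst (_≤ length t) (+-suc q (length w)) fits

count-left-extension :
  ∀ (t w : Word) {p} → Occurs t w (suc p) →
  (∀ {q} → Occurs t w (suc q) → nth t q ≡ nth t p → q ≡ p) →
  count t (sub t (suc p) (suc (p + length w))) ≡ 1
count-left-extension t w {p} (room , w-at-1+p) unique =
  count-factor t (s≤s (m≤m+n p _)) room from-extension
  where
  from-extension : ∀ {q} → Occurs t (sub t (suc p) (suc (p + length w))) q → q ≡ p
  from-extension {q} occ with Occurs-extension t w room occ
  ... | fits , matches = unique (subst (_≤ length t) (+-suc q (length w)) fits , shifted) first-letter
    where
    shifted : ∀ j → j < length w → nth t (suc q + j) ≡ nth w j
    shifted j j<w = begin
      nth t (suc q + j) ≡⟨ cong (nth t) (+-suc q j) ⟨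
      nth t (q + suc j) ≡⟨ matches (suc j) j<w ⟩
      nth t (p + suc j) ≡⟨ cong (nth t) (+-suc p j) ⟩
      nth t (suc p + j) ≡⟨ w-at-1+p j j<w ⟩
      nth w j           ∎
      where open ≡-Reasoning
    first-letter : nth t q ≡ nth t p
    first-letter = subst₂ (λ i i′ → nth t i ≡ nth t i′) (+-identityʳ q) (+-identityʳ p) (matches 0 z≤n)

net-occurrence :
  ∀ (t w : Word) {p} → Occurs t w p → 2 ≤ count t w →
  p ≡ 0 ⊎ count t (sub t p (p + length w)) ≡ 1 →
  p + length w ≡ length t ⊎ count t (sub t (suc p) (suc (p + length w))) ≡ 1 →
  T (occursAt t w (suc p) ∧ isNet t (suc p) (p + length w))
net-occurrence t w {p} occ repeated left right =
  both (Occurs⇒occursAt t w occ)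
       (both repeated′ (both (either (Sum.map (≡⇒≡ᵇ _ _ ∘ cong suc) (≡⇒≡ᵇ _ _) left))
                             (either (Sum.map (≡⇒≡ᵇ _ _) (≡⇒≡ᵇ _ _) right))))
  where
  both : ∀ {x y} → T x → T y → T (x ∧ y)
  both Tx Ty = Equivalence.from T-∧ (Tx , Ty)
  either : ∀ {x y} → T x ⊎ T y → T (x ∨ y)
  either = Equivalence.from T-∨
  repeated′ : T (2 ≤ᵇ count t (sub t (suc p) (p + length w)))
  repeated′ = ≤⇒≤ᵇ (subst (λ v → 2 ≤ count t v) (sym (sub-Occurs t w occ)) repeated)

module FibonacciText (k : ℕ) where

  t : Word
  t = F (7 + k)

  S : Word
  S = Sw (7 + k)

  A : ℕ
  A = f (5 + k)

  m : ℕ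
  m = f (6 + k) ∸ 2

  m+2≡f₆ : m + 2 ≡ f (6 + k)
  m+2≡f₆ = m∸n+n≡m (2≤f[3+k] (3 + k))

  |t|≡A+m+2 : length t ≡ A + m + 2
  |t|≡A+m+2 = trans (f-rec (4 + k)) (trans (cong (_+ A) (sym m+2≡f₆)) (rearrange m A))
    where
    rearrange : ∀ m A → m + 2 + A ≡ A + m + 2
    rearrange = solve-∀

  A+m<|t| : A + m < length t
  A+m<|t| = subst (A + m <_) (sym |t|≡A+m+2) (m<m+n (A + m) (s≤s z≤n))

  A<|t| : A < length t
  A<|t| = ≤-<-trans (m≤m+n A m) A+m<|t|

  m<|t| : m < length t
  m<|t| = ≤-<-trans (m≤n+m m A) A+m<|t|

  0<A : 0 < A
  0<A = f-mono-≤ {1} {5 + k} (s≤s z≤n)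

  4≤m : 4 ≤ m
  4≤m = +-cancelʳ-≤ 2 4 m (≤-trans (m≤m+n 6 2) (subst (8 ≤_) (sym m+2≡f₆) (f-mono-≤ (m≤m+n 6 k))))

  length-S : length S ≡ m
  length-S = trans (length-take m (F (6 + k))) (m≤n⇒m⊓n≡m (m∸n≤m _ 2))

  nth-t : ∀ {j} → j < length t → nth t j ≡ fib∞ j
  nth-t = nth-F (5 + k)

  nth-S : ∀ {j} → j < m → nth S j ≡ fib∞ j
  nth-S {j} j<m =
    trans (nth-take m (F (6 + k)) (subst (j <_) (sym length-S) j<m))
          (nth-F (4 + k) (<-≤-trans j<m (m∸n≤m _ 2)))

  Occurs-S⁺ : ∀ {p} → p + m ≤ length t → (∀ j → j < m → fib∞ (p + j) ≡ fib∞ j) → Occurs t S p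
  Occurs-S⁺ {p} fits matches = subst (λ l → p + l ≤ length t) (sym length-S) fits , matches′
    where
    matches′ : ∀ j → j < length S → nth t (p + j) ≡ nth S j
    matches′ j j<S = let j<m = subst (j <_) length-S j<S in
      trans (nth-t (<-≤-trans (+-monoʳ-< p j<m) fits)) (trans (matches j j<m) (sym (nth-S j<m)))

  Occurs-S⁻ : ∀ {p} → Occurs t S p → p + m ≤ length t × (∀ j → j < m → fib∞ (p + j) ≡ fib∞ j)
  Occurs-S⁻ {p} (fits , matches) = fits′ , matches′
    where
    fits′ : p + m ≤ length t
    fits′ = subst (λ l → p + l ≤ length t) length-S fits
    matches′ : ∀ j → j < m → fib∞ (p + j) ≡ fib∞ j
    matches′ j j<m =
      trans (sym (nth-t (<-≤-trans (+-monoʳ-< p j<m) fits′)))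
            (trans (matches j (subst (j <_) (sym length-S) j<m)) (nth-S j<m))

  fib∞-shift-A : ∀ {j} → j < m → fib∞ (A + j) ≡ fib∞ j
  fib∞-shift-A {j} j<m = fib∞-period (3 + k) j (subst (j + 2 <_) m+2≡f₆ (+-monoˡ-< 2 j<m))

  S-at-0 : Occurs t S 0
  S-at-0 = Occurs-S⁺ (<⇒≤ m<|t|) (λ _ _ → refl)

  S-at-A : Occurs t S A
  S-at-A = Occurs-S⁺ (<⇒≤ A+m<|t|) (λ _ → fib∞-shift-A)

  no-occurrence-before-A : ∀ {p} → Occurs t S p → 0 < p → p < A → ⊥
  no-occurrence-before-A {p} occ 0<p p<A = no-short-period (5 + k) 0<p p<A f₆≤1+p+m periodic
    where
    f₆≤1+p+m : f (6 + k) ≤ suc (p + m)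
    f₆≤1+p+m = subst (_≤ suc (p + m)) (trans (+-comm 2 m) m+2≡f₆) (s≤s (+-monoˡ-≤ m 0<p))
    periodic : Periodic (p + m) p
    periodic j j+p<p+m = trans (sym (proj₂ (Occurs-S⁻ occ) j j<m)) (cong fib∞ (+-comm p j))
      where
      j<m : j < m
      j<m = +-cancelʳ-< p j m (subst (j + p <_) (+-comm p m) j+p<p+m)

  -- S would then occur at A and at A + d, so S itself would have the period d ≤ 2.
  no-occurrence-after-A : ∀ {d} → Occurs t S (A + d) → 0 < d → ⊥
  no-occurrence-after-A {d} occ 0<d = no-short-period 4 0<d (s≤s d≤2) (s≤s 4≤m) periodic
    where
    d≤2 : d ≤ 2
    d≤2 = +-cancelˡ-≤ (A + m) d 2 (subst₂ _≤_ (rearrange A d m) |t|≡A+m+2 (proj₁ (Occurs-S⁻ occ)))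
      where
      rearrange : ∀ A d m → A + d + m ≡ A + m + d
      rearrange = solve-∀
    periodic : Periodic m d
    periodic j j+d<m = begin
      fib∞ j             ≡⟨ proj₂ (Occurs-S⁻ occ) j (m+n≤o⇒m≤o (suc j) j+d<m) ⟨
      fib∞ (A + d + j)   ≡⟨ cong fib∞ (+-assoc A d j) ⟩
      fib∞ (A + (d + j)) ≡⟨ fib∞-shift-A (subst (_< m) (+-comm j d) j+d<m) ⟩
      fib∞ (d + j)       ≡⟨ cong fib∞ (+-comm d j) ⟩
      fib∞ (j + d)       ∎
      where open ≡-Reasoning

  S-occurrences : ∀ {p} → Occurs t S p → p ≡ 0 ⊎ p ≡ A
  S-occurrences {p} occ with <-cmp p A
  ... | tri≈ _ p≡A _ = inj₂ p≡A
  S-occurrences {zero}  occ | tri< _ _ _ = inj₁ refl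
  S-occurrences {suc p} occ | tri< p<A _ _ = ⊥-elim (no-occurrence-before-A occ (s≤s z≤n) p<A)
  S-occurrences {p}     occ | tri> _ _ A<p =
    ⊥-elim (no-occurrence-after-A (subst (Occurs t S) (sym (m+[n∸m]≡n (<⇒≤ A<p))) occ) (m<n⇒0<n∸m A<p))

  -- These are the penultimate letters of F (6 + k) and F (7 + k).
  right-letters-differ : nth t (length S) ≢ nth t (A + length S)
  right-letters-differ rewrite length-S = λ same → fib∞-penultimate (3 + k) (begin
    fib∞ m                ≡⟨ nth-t m<|t| ⟨
    nth t m               ≡⟨ same ⟩
    nth t (A + m)         ≡⟨ nth-t A+m<|t| ⟩
    fib∞ (A + m)          ≡⟨ cong fib∞ (m+n∸n≡m (A + m) 2) ⟨
    fib∞ (A + m + 2 ∸ 2)  ≡⟨ cong (λ l → fib∞ (l ∸ 2)) |t|≡A+m+2 ⟨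
    fib∞ (f (7 + k) ∸ 2)  ∎)
    where open ≡-Reasoning

  right-extension-unique : ∀ {p q} → Occurs t S p → Occurs t S q →
                           nth t (q + length S) ≡ nth t (p + length S) → q ≡ p
  right-extension-unique occp occq same with S-occurrences occp | S-occurrences occq
  ... | inj₁ refl | inj₁ refl = refl
  ... | inj₂ refl | inj₂ refl = refl
  ... | inj₁ refl | inj₂ refl = ⊥-elim (right-letters-differ (sym same))
  ... | inj₂ refl | inj₁ refl = ⊥-elim (right-letters-differ same)

  S-repeats : 2 ≤ count t S
  S-repeats = tally-two (occursAt t S) 0<A A<|t|
                (Occurs⇒occursAt t S S-at-0) (Occurs⇒occursAt t S S-at-A)

  net-at-0 : T (occursAt t S 1 ∧ isNet t 1 (length S))
  net-at-0 = net-occurrence t S S-at-0 S-repeats (inj₁ refl)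
    (inj₂ (count-right-extension t S S-at-0 (subst (_< length t) (sym length-S) m<|t|)
             (λ occ _ → right-extension-unique S-at-0 occ)))

  net-at-A : T (occursAt t S (suc A) ∧ isNet t (suc A) (A + length S))
  net-at-A = net-occurrence t S S-at-A S-repeats (inj₂ left) (inj₂ right)
    where
    right : count t (sub t (suc A) (suc (A + length S))) ≡ 1
    right = count-right-extension t S S-at-A (subst (λ l → A + l < length t) (sym length-S) A+m<|t|)
              (λ occ _ → right-extension-unique S-at-A occ)
    1+[A∸1]≡A : suc (A ∸ 1) ≡ A
    1+[A∸1]≡A = m+[n∸m]≡n 0<A
    at-A : ∀ {q} → Occurs t S (suc q) → suc q ≡ A
    at-A occ with S-occurrences occ
    ... | inj₂ 1+q≡A = 1+q≡A
    left : count t (sub t A (A + length S)) ≡ 1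
    left = subst (λ p → count t (sub t p (p + length S)) ≡ 1) 1+[A∸1]≡A
      (count-left-extension t S (subst (Occurs t S) (sym 1+[A∸1]≡A) S-at-A)
        (λ occ _ → suc-injective (trans (at-A occ) (sym 1+[A∸1]≡A))))

theorem11 : (i : ℕ) → i ≥ 7 → netFreq (F i) (Sw i) ≥ 2
theorem11 i i≥7 with m≤n⇒∃[o]m+o≡n i≥7
... | k , refl = tally-two _ 0<A A<|t| net-at-0 net-at-A
  where open FibonacciText k
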